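{- For every positive integer $k$, in one shortest period $(\Phi_{5^k}(n))_{n=1}^{N_k}$ of the sequence of $5^k$'s place digits of the Fibonacci numbers in base $5$, each of the digits $0,1,2,3,4$ occurs with frequency exactly $1/5$.
   Context: The Fibonacci numbers are $F_0=0$, $F_1=1$, $F_n=F_{n-1}+F_{n-2}$. For a base $\beta$ and $k\ge0$, $\Phi_{\beta^k}(n)=\lfloor F_n/\beta^k\rfloor \bmod \beta$; this sequence in $n$ is periodic, and $N_k$ denotes the length of its shortest period. -}

module Defs where

open import Data.Nat using (ℕ; zero; suc; _+_; _*_; _^_; _<_; _≤_; _≡ᵇ_; NonZero)
open import Data.Nat.DivMod using (_/_; _%_)
open import Data.Nat.Properties using (m^n≢0)
open import Data.Bool using (if_then_else_)
open import Relation.Binary.PropositionalEquality using (_≡_)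

fib : ℕ → ℕ
fib zero = zero
fib (suc zero) = suc zero
fib (suc (suc n)) = fib (suc n) + fib n

Φ : (β : ℕ) .{{_ : NonZero β}} → ℕ → ℕ → ℕ
Φ β k n = (_/_ (fib n) (β ^ k) {{m^n≢0 β k}}) % β

IsPeriod : (β : ℕ) .{{_ : NonZero β}} → ℕ → ℕ → Set
IsPeriod β k p = (0 < p) × (∀ n → Φ β k (n + p) ≡ Φ β k n)
  where open import Data.Product using (_×_)

IsShortestPeriod : (β : ℕ) .{{_ : NonZero β}} → ℕ → ℕ → Set
IsShortestPeriod β k N = IsPeriod β k N × (∀ p → IsPeriod β k p → N ≤ p)
  where open import Data.Product using (_×_)

countDigit : (β : ℕ) .{{_ : NonZero β}} → ℕ → ℕ → ℕ → ℕ
countDigit β k d zero = zero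
countDigit β k d (suc m) =
  countDigit β k d m + (if Φ β k (suc m) ≡ᵇ d then 1 else 0)

-- Fix k ≥ 1 and e = 5^k.  In ℤ[φ], φ² = φ + 1, some power φ^m equals 1 + e (a + b φ) with
-- a ≡ 1 and b ≡ 3 (mod 5): for k = 1 take m = 20, and raising to the fifth power passes from k
-- to k + 1, since (1 + e Z)⁵ ≡ 1 + 5e Z modulo 25e.  Comparing coefficients in φ^(n+m) = φ^n φ^m
-- gives F_{n+m} = F_n + e (a F_n + b F_{n+1}), so advancing n by m adds c_n = F_n + 3 F_{n+1} to the
-- digit Φ_{5^k}(n) modulo 5, where c_n is m-periodic modulo 5 and never divisible by 5.  Hence 5m is
-- a period, and the digits at n, n + m, …, n + 4m are pairwise distinct, so each digit occurs m times
-- in it.  The shortest period N divides 5m, and digit counts over 5m are 5m/N times those over N.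
module Submission where

open import Defs
open import Data.Nat using (ℕ; _<_; _≤_)
open import Algebra.Bundles.Raw using (RawSemiring)
open import Level using (0ℓ)
open import Data.Bool using (if_then_else_)
open import Data.Nat.Properties
open import Data.Nat.DivMod
open import Data.Nat.Divisibility using (_∣_; _∣?_; m∣m*n; ∣m⇒∣m*n; ∣m∣n⇒∣m+n; m%n≡0⇒n∣m)
open import Data.Nat.Coprimality using (coprime?; coprime-divisor)
open import Data.Nat.Solver using (module +-*-Solver)
open import Data.Nat.Tactic.RingSolver using (solve-∀)
open import Data.Product using (_×_; _,_; proj₁; proj₂)
open import Data.Sum using (_⊎_; inj₁; inj₂)
open import Data.Empty using (⊥-elim)
open import Relation.Nullary using (¬_; Dec)
open import Relation.Nullary.Decidable using (toWitness; toWitnessFalse; from-yes; _⊎-dec_)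
open import Relation.Binary.PropositionalEquality using (_≡_; refl; sym; trans; cong; cong₂; subst; module ≡-Reasoning)

open +-*-Solver using (solve; _:=_; _:+_; _:*_; con; Polynomial)

-- (x₀ , x₁) stands for x₀ + x₁ φ with φ² = φ + 1.  The operations are defined over any raw
-- semiring so that identities between them can be checked on polynomial syntax by the solver.
module GoldenPairs (R : RawSemiring 0ℓ 0ℓ) (num : ℕ → RawSemiring.Carrier R) where
  open RawSemiring R

  infixl 6 _⊕_
  infixr 6.5 _·_
  infixl 7 _⊗_

  _⊕_ : Carrier × Carrier → Carrier × Carrier → Carrier × Carrier
  (x₀ , x₁) ⊕ (y₀ , y₁) = x₀ + y₀ , x₁ + y₁

  _·_ : Carrier → Carrier × Carrier → Carrier × Carrier
  c · (x₀ , x₁) = c * x₀ , c * x₁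

  _⊗_ : Carrier × Carrier → Carrier × Carrier → Carrier × Carrier
  (x₀ , x₁) ⊗ (y₀ , y₁) = x₀ * y₀ + x₁ * y₁ , x₀ * y₁ + x₁ * y₀ + x₁ * y₁

  one : Carrier × Carrier
  one = 1# , 0#

  fifthPower : Carrier × Carrier → Carrier × Carrier
  fifthPower X = X ⊗ X ⊗ X ⊗ X ⊗ X

  -- (1 + 5f Z)⁵ = 1 + 25f (Z + 5 · binomialCarry f Z), as 5 divides the middle binomial coefficients.
  binomialCarry : Carrier → Carrier × Carrier → Carrier × Carrier
  binomialCarry f Z = f · (num 2 · Z ⊗ Z ⊕ (num 10 * f) · Z ⊗ Z ⊗ Z
                          ⊕ (num 25 * (f * f)) · Z ⊗ Z ⊗ Z ⊗ Z ⊕ (num 25 * (f * (f * f))) · Z ⊗ Z ⊗ Z ⊗ Z ⊗ Z)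

-- Opened only now, so that ℕ's _+_ and _*_ do not clash with the semiring operations above.
open import Data.Nat using (zero; suc; _+_; _*_; _^_; _≡ᵇ_; NonZero; +-*-rawSemiring; >-nonZero; z<s)

sumBelow : ℕ → (ℕ → ℕ) → ℕ
sumBelow zero    g = 0
sumBelow (suc n) g = sumBelow n g + g n

syntax sumBelow n (λ i → e) = ∑[ i < n ] e

sumBelow-cong : ∀ n {g h : ℕ → ℕ} → (∀ i → g i ≡ h i) → sumBelow n g ≡ sumBelow n h
sumBelow-cong zero    g≡h = refl
sumBelow-cong (suc n) g≡h = cong₂ _+_ (sumBelow-cong n g≡h) (g≡h n)

sumBelow-+ : ∀ m n (g : ℕ → ℕ) → sumBelow (m + n) g ≡ sumBelow m g + ∑[ i < n ] g (m + i)
sumBelow-+ m zero    g = trans (cong (λ l → sumBelow l g) (+-identityʳ m)) (sym (+-identityʳ _))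
sumBelow-+ m (suc n) g = begin
  sumBelow (m + suc n) g                           ≡⟨ cong (λ l → sumBelow l g) (+-suc m n) ⟩
  sumBelow (m + n) g + g (m + n)                   ≡⟨ cong (_+ g (m + n)) (sumBelow-+ m n g) ⟩
  sumBelow m g + ∑[ i < n ] g (m + i) + g (m + n)  ≡⟨ +-assoc (sumBelow m g) _ _ ⟩
  sumBelow m g + ∑[ i < suc n ] g (m + i)          ∎
  where open ≡-Reasoning

sumBelow-distrib : ∀ n (g h : ℕ → ℕ) → ∑[ i < n ] (g i + h i) ≡ sumBelow n g + sumBelow n h
sumBelow-distrib zero    g h = refl
sumBelow-distrib (suc n) g h = begin
  ∑[ i < n ] (g i + h i) + (g n + h n)                ≡⟨ cong (_+ (g n + h n)) (sumBelow-distrib n g h) ⟩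
  (sumBelow n g + sumBelow n h) + (g n + h n)         ≡⟨ +-assoc-swap (sumBelow n g) (sumBelow n h) (g n) (h n) ⟩
  (sumBelow n g + g n) + (sumBelow n h + h n)         ∎
  where
  open ≡-Reasoning
  +-assoc-swap : ∀ w x y z → (w + x) + (y + z) ≡ (w + y) + (x + z)
  +-assoc-swap = solve-∀

sumBelow-ones : ∀ n → ∑[ i < n ] 1 ≡ n
sumBelow-ones zero    = refl
sumBelow-ones (suc n) = trans (cong (_+ 1) (sumBelow-ones n)) (+-comm n 1)

sumBelow-blocks : ∀ q m (g : ℕ → ℕ) → sumBelow (q * m) g ≡ ∑[ i < m ] ∑[ j < q ] g (j * m + i)
sumBelow-blocks zero    m g = sym (zeros m)
  where
  zeros : ∀ n → ∑[ i < n ] 0 ≡ 0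
  zeros zero    = refl
  zeros (suc n) = trans (+-identityʳ _) (zeros n)
sumBelow-blocks (suc q) m g = begin
  sumBelow (m + q * m) g                                       ≡⟨ sumBelow-+ m (q * m) g ⟩
  sumBelow m g + ∑[ i < q * m ] g (m + i)                      ≡⟨ cong (sumBelow m g +_) (sumBelow-blocks q m (λ i → g (m + i))) ⟩
  sumBelow m g + ∑[ i < m ] ∑[ j < q ] g (m + (j * m + i))     ≡⟨ sym (sumBelow-distrib m g _) ⟩
  ∑[ i < m ] (g i + ∑[ j < q ] g (m + (j * m + i)))            ≡⟨ sumBelow-cong m first-block ⟩
  ∑[ i < m ] ∑[ j < suc q ] g (j * m + i)                      ∎
  where
  open ≡-Reasoning
  first-block : ∀ i → g i + ∑[ j < q ] g (m + (j * m + i)) ≡ ∑[ j < suc q ] g (j * m + i)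
  first-block i = sym (trans (sumBelow-+ 1 q (λ j → g (j * m + i)))
    (cong (g i +_) (sumBelow-cong q (λ j → cong g (+-assoc m (j * m) i)))))

sumBelow-periodic : ∀ q N (g : ℕ → ℕ) → (∀ i → g (N + i) ≡ g i) → sumBelow (q * N) g ≡ q * sumBelow N g
sumBelow-periodic zero    N g periodic = refl
sumBelow-periodic (suc q) N g periodic = begin
  sumBelow (N + q * N) g                   ≡⟨ sumBelow-+ N (q * N) g ⟩
  sumBelow N g + ∑[ i < q * N ] g (N + i)  ≡⟨ cong (sumBelow N g +_) (sumBelow-cong (q * N) periodic) ⟩
  sumBelow N g + sumBelow (q * N) g        ≡⟨ cong (sumBelow N g +_) (sumBelow-periodic q N g periodic) ⟩
  sumBelow N g + q * sumBelow N g          ∎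
  where open ≡-Reasoning

infix 4 _≡_[mod_]

record _≡_[mod_] (x y d : ℕ) .{{_ : NonZero d}} : Set where
  constructor mod-≡
  field %-≡ : x % d ≡ y % d

open _≡_[mod_]

module _ {d : ℕ} .{{_ : NonZero d}} where

  ≡⇒≡-mod : ∀ {x y} → x ≡ y → x ≡ y [mod d ]
  ≡⇒≡-mod x≡y = mod-≡ (cong (_% d) x≡y)

  ≡-mod-sym : ∀ {x y} → x ≡ y [mod d ] → y ≡ x [mod d ]
  ≡-mod-sym (mod-≡ x≡y) = mod-≡ (sym x≡y)

  ≡-mod-trans : ∀ {x y z} → x ≡ y [mod d ] → y ≡ z [mod d ] → x ≡ z [mod d ]
  ≡-mod-trans (mod-≡ x≡y) (mod-≡ y≡z) = mod-≡ (trans x≡y y≡z)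

  %-≡-mod : ∀ x → x % d ≡ x [mod d ]
  %-≡-mod x = mod-≡ (m%n%n≡m%n x d)

  +-multiple-≡-mod : ∀ x {y} → d ∣ y → x + y ≡ x [mod d ]
  +-multiple-≡-mod x d∣y = mod-≡ (%-remove-+ʳ x d∣y)

  +-cong-mod : ∀ {x x′ y y′} → x ≡ x′ [mod d ] → y ≡ y′ [mod d ] → x + y ≡ x′ + y′ [mod d ]
  +-cong-mod {x} {x′} {y} {y′} (mod-≡ x≡x′) (mod-≡ y≡y′) = mod-≡ (begin
    (x + y) % d                ≡⟨ %-distribˡ-+ x y d ⟩
    (x % d + y % d) % d        ≡⟨ cong₂ (λ u v → (u + v) % d) x≡x′ y≡y′ ⟩
    (x′ % d + y′ % d) % d      ≡⟨ %-distribˡ-+ x′ y′ d ⟨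
    (x′ + y′) % d              ∎)
    where open ≡-Reasoning

  *-cong-mod : ∀ {x x′ y y′} → x ≡ x′ [mod d ] → y ≡ y′ [mod d ] → x * y ≡ x′ * y′ [mod d ]
  *-cong-mod {x} {x′} {y} {y′} (mod-≡ x≡x′) (mod-≡ y≡y′) = mod-≡ (begin
    (x * y) % d                ≡⟨ %-distribˡ-* x y d ⟩
    (x % d * (y % d)) % d      ≡⟨ cong₂ (λ u v → (u * v) % d) x≡x′ y≡y′ ⟩
    (x′ % d * (y′ % d)) % d    ≡⟨ %-distribˡ-* x′ y′ d ⟨
    (x′ * y′) % d              ∎)
    where open ≡-Reasoning

  arithmetic-progression-mod : ∀ m (f g : ℕ → ℕ) →
    (∀ p → g (p + m) ≡ g p [mod d ]) → (∀ p → f (p + m) ≡ f p + g p [mod d ]) →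
    ∀ j n → f (j * m + n) ≡ f n + j * g n [mod d ]
  arithmetic-progression-mod m f g g-step f-step = progression
    where
    shift : ∀ j n → (suc j) * m + n ≡ j * m + n + m
    shift j n = rotate m (j * m) n
      where
      rotate : ∀ x y z → x + y + z ≡ y + z + x
      rotate = solve-∀
    constant : ∀ j n → g (j * m + n) ≡ g n [mod d ]
    constant zero    n = ≡⇒≡-mod refl
    constant (suc j) n = ≡-mod-trans (≡⇒≡-mod (cong g (shift j n))) (≡-mod-trans (g-step (j * m + n)) (constant j n))
    progression : ∀ j n → f (j * m + n) ≡ f n + j * g n [mod d ]
    progression zero    n = ≡⇒≡-mod (sym (+-identityʳ (f n)))
    progression (suc j) n =
      ≡-mod-trans (≡⇒≡-mod (cong f (shift j n)))
      (≡-mod-trans (f-step (j * m + n))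
      (≡-mod-trans (+-cong-mod (progression j n) (constant j n))
                   (≡⇒≡-mod (+-assoc-comm (f n) (j * g n) (g n)))))
      where
      +-assoc-comm : ∀ x y z → x + y + z ≡ x + (z + y)
      +-assoc-comm = solve-∀

indicator : ℕ → ℕ → ℕ
indicator d v = if v ≡ᵇ d then 1 else 0

private
  HitsOnce : ℕ → ℕ → ℕ → Set
  HitsOnce x r d = r ≡ 0 ⊎ ∑[ j < 5 ] indicator d ((x + j * r) % 5) ≡ 1

  hitsOnce? : ∀ x r d → Dec (HitsOnce x r d)
  hitsOnce? x r d = (r ≟ 0) ⊎-dec (∑[ j < 5 ] indicator d ((x + j * r) % 5) ≟ 1)

  hitsOnce-table : ∀ {x} → x < 5 → ∀ {r} → r < 5 → ∀ {d} → d < 5 → HitsOnce x r d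
  hitsOnce-table = toWitness {a? = allUpTo? (λ x → allUpTo? (λ r → allUpTo? (hitsOnce? x r) 5) 5) 5} _

residues-hit-once : ∀ x r d → x < 5 → ¬ 5 ∣ r → d < 5 → ∑[ j < 5 ] indicator d ((x + j * r) % 5) ≡ 1
residues-hit-once x r d x<5 5∤r d<5 with hitsOnce-table x<5 (m%n<n r 5) d<5
... | inj₁ r%5≡0 = ⊥-elim (5∤r (m%n≡0⇒n∣m r 5 r%5≡0))
... | inj₂ once  = trans (sumBelow-cong 5 reduce) once
  where
  reduce : ∀ j → indicator d ((x + j * r) % 5) ≡ indicator d ((x + j * (r % 5)) % 5)
  reduce j = cong (indicator d) (%-≡ (+-cong-mod (≡⇒≡-mod {x = x} refl) (*-cong-mod (≡⇒≡-mod {x = j} refl) (≡-mod-sym (%-≡-mod r)))))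

fib-+ : ∀ n s → fib (n + suc s) ≡ fib n * fib s + fib (suc n) * fib (suc s)
fib-+ zero          s = sym (+-identityʳ (fib (suc s)))
fib-+ (suc zero)    s = trans (+-comm (fib (suc s)) (fib s)) (sym (cong₂ _+_ (+-identityʳ (fib s)) (+-identityʳ (fib (suc s)))))
fib-+ (suc (suc n)) s = trans (cong₂ _+_ (fib-+ (suc n) s) (fib-+ n s)) (regroup (fib n) (fib (suc n)) (fib s) (fib (suc s)))
  where
  regroup : ∀ x y u v → (y * u + (y + x) * v) + (x * u + y * v) ≡ (y + x) * u + ((y + x) + y) * v
  regroup = solve-∀

open GoldenPairs +-*-rawSemiring (λ n → n)

polynomialRawSemiring : ℕ → RawSemiring 0ℓ 0ℓ
polynomialRawSemiring n = record
  { Carrier = Polynomial n ; _≈_ = _≡_ ; _+_ = _:+_ ; _*_ = _:*_ ; 0# = con 0 ; 1# = con 1 }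

fifthPower-near-one : ∀ f a b →
  fifthPower (one ⊕ (5 * f) · (a , b)) ≡ one ⊕ (5 * (5 * f)) · ((a , b) ⊕ 5 · binomialCarry f (a , b))
fifthPower-near-one f a b = cong₂ _,_
  (solve 3 (λ f a b → proj₁ (lhs f a b) := proj₁ (rhs f a b)) refl f a b)
  (solve 3 (λ f a b → proj₂ (lhs f a b) := proj₂ (rhs f a b)) refl f a b)
  where
  module P = GoldenPairs (polynomialRawSemiring 3) con
  lhs rhs : Polynomial 3 → Polynomial 3 → Polynomial 3 → Polynomial 3 × Polynomial 3
  lhs f a b = P.fifthPower (P.one P.⊕ (con 5 :* f) P.· (a , b))
  rhs f a b = P.one P.⊕ (con 5 :* (con 5 :* f)) P.· ((a , b) P.⊕ con 5 P.· P.binomialCarry f (a , b))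

-- φ^(n+1) = F_n + F_{n+1} φ.
fibPair : ℕ → ℕ × ℕ
fibPair n = fib n , fib (suc n)

fibPair-+ : ∀ n s → fibPair (n + suc s) ≡ fibPair n ⊗ fibPair s
fibPair-+ n s = cong₂ _,_ (fib-+ n s) (trans (fib-+ (suc n) s) (regroup (fib n) (fib (suc n)) (fib s) (fib (suc s))))
  where
  regroup : ∀ x y u v → y * u + (y + x) * v ≡ x * v + y * u + y * v
  regroup = solve-∀

record FibonacciReturn (k : ℕ) : Set where
  field
    index a b     : ℕ
    fibPair-index : fibPair index ≡ (1 + 5 ^ k * a , 5 ^ k * b)
    a≡1           : a ≡ 1 [mod 5 ]
    b≡3           : b ≡ 3 [mod 5 ]

fibonacciReturn-lift : ∀ {k} → FibonacciReturn (suc k) → FibonacciReturn (suc (suc k))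
fibonacciReturn-lift {k} R = record
  { index         = index + m + m + m + m
  ; a             = a + 5 * proj₁ carry
  ; b             = b + 5 * proj₂ carry
  ; fibPair-index = fifthPower-index
  ; a≡1           = ≡-mod-trans (+-multiple-≡-mod a (m∣m*n (proj₁ carry))) a≡1
  ; b≡3           = ≡-mod-trans (+-multiple-≡-mod b (m∣m*n (proj₂ carry))) b≡3
  }
  where
  open FibonacciReturn R
  m : ℕ
  m = suc index
  X carry : ℕ × ℕ
  X = fibPair index
  carry = binomialCarry (5 ^ k) (a , b)
  fifthPower-index : fibPair (index + m + m + m + m) ≡
    (1 + 5 ^ suc (suc k) * (a + 5 * proj₁ carry) , 5 ^ suc (suc k) * (b + 5 * proj₂ carry))
  fifthPower-index = begin
    fibPair (index + m + m + m + m)  ≡⟨ fibPair-+ (index + m + m + m) index ⟩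
    fibPair (index + m + m + m) ⊗ X  ≡⟨ cong (_⊗ X) (fibPair-+ (index + m + m) index) ⟩
    fibPair (index + m + m) ⊗ X ⊗ X  ≡⟨ cong (λ Y → Y ⊗ X ⊗ X) (fibPair-+ (index + m) index) ⟩
    fibPair (index + m) ⊗ X ⊗ X ⊗ X  ≡⟨ cong (λ Y → Y ⊗ X ⊗ X ⊗ X) (fibPair-+ index index) ⟩
    fifthPower X                     ≡⟨ cong fifthPower fibPair-index ⟩
    fifthPower (one ⊕ (5 * 5 ^ k) · (a , b)) ≡⟨ fifthPower-near-one (5 ^ k) a b ⟩
    one ⊕ (5 * (5 * 5 ^ k)) · ((a , b) ⊕ 5 · carry) ∎
    where open ≡-Reasoning

fibonacciReturn : ∀ k → FibonacciReturn (suc k)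
-- F₁₉ = 4181 = 1 + 5 · 836 and F₂₀ = 6765 = 5 · 1353.
fibonacciReturn zero    = record { index = 19 ; a = 836 ; b = 1353 ; fibPair-index = refl ; a≡1 = mod-≡ refl ; b≡3 = mod-≡ refl }
fibonacciReturn (suc k) = fibonacciReturn-lift (fibonacciReturn k)

increment : ℕ → ℕ
increment n = fib n + 3 * fib (suc n)

-- increment n ≡ −Lₙ (mod 5) for the Lucas numbers Lₙ, and no Lucas number is divisible by 5.
5∤increment : ∀ n → ¬ 5 ∣ increment n
5∤increment zero    = toWitnessFalse {a? = 5 ∣? 3} _
5∤increment (suc n) 5∣increment = 5∤increment n (coprime-divisor (from-yes (coprime? 5 3))
  (subst (5 ∣_) (increment-step (fib n) (fib (suc n))) (∣m∣n⇒∣m+n 5∣increment (m∣m*n (fib (suc n))))))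
  where
  increment-step : ∀ x y → y + 3 * (y + x) + 5 * y ≡ 3 * (x + 3 * y)
  increment-step = solve-∀

countDigit-sum : ∀ β .{{_ : NonZero β}} k d L → countDigit β k d L ≡ ∑[ i < L ] indicator d (Φ β k (suc i))
countDigit-sum β k d zero    = refl
countDigit-sum β k d (suc L) = cong (_+ indicator d (Φ β k (suc L))) (countDigit-sum β k d L)

module ReturnPeriod {k : ℕ} (R : FibonacciReturn (suc k)) where
  open FibonacciReturn R

  e m : ℕ
  e = 5 ^ suc k
  m = suc index

  instance
    e≢0 : NonZero e
    e≢0 = m^n≢0 5 (suc k)

  fib-return : ∀ n → fib (n + m) ≡ fib n + e * (a * fib n + b * fib (suc n))
  fib-return n = begin
    fib (n + m)                                      ≡⟨ fib-+ n index ⟩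
    fib n * fib index + fib (suc n) * fib (suc index) ≡⟨ cong₂ (λ x y → fib n * x + fib (suc n) * y) (cong proj₁ fibPair-index) (cong proj₂ fibPair-index) ⟩
    fib n * (1 + e * a) + fib (suc n) * (e * b)       ≡⟨ expand (fib n) (fib (suc n)) e a b ⟩
    fib n + e * (a * fib n + b * fib (suc n))         ∎
    where
    open ≡-Reasoning
    expand : ∀ x y e a b → x * (1 + e * a) + y * (e * b) ≡ x + e * (a * x + b * y)
    expand = solve-∀

  fib-return-mod : ∀ n → fib (n + m) ≡ fib n [mod 5 ]
  fib-return-mod n = ≡-mod-trans (≡⇒≡-mod (fib-return n)) (+-multiple-≡-mod (fib n) (∣m⇒∣m*n _ (m∣m*n (5 ^ k))))

  increment-return : ∀ n → increment (n + m) ≡ increment n [mod 5 ]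
  increment-return n = +-cong-mod (fib-return-mod n) (*-cong-mod (≡⇒≡-mod {x = 3} refl) (fib-return-mod (suc n)))

  digit-return : ∀ n → Φ 5 (suc k) (n + m) ≡ Φ 5 (suc k) n + increment n [mod 5 ]
  digit-return n = mod-≡ (begin
    Φ 5 (suc k) (n + m) % 5           ≡⟨ m%n%n≡m%n (fib (n + m) / e) 5 ⟩
    (fib (n + m) / e) % 5             ≡⟨ cong (λ x → (x / e) % 5) (fib-return n) ⟩
    ((fib n + e * t) / e) % 5         ≡⟨ cong (_% 5) (+-distrib-/-∣ʳ (fib n) (m∣m*n t)) ⟩
    (fib n / e + e * t / e) % 5       ≡⟨ cong (λ u → (fib n / e + u) % 5) (trans (/-congˡ (*-comm e t)) (m*n/n≡m t e)) ⟩
    (fib n / e + t) % 5               ≡⟨ %-≡ (+-cong-mod (≡-mod-sym (%-≡-mod (fib n / e))) t≡increment) ⟩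
    (Φ 5 (suc k) n + increment n) % 5 ∎)
    where
    open ≡-Reasoning
    t : ℕ
    t = a * fib n + b * fib (suc n)
    t≡increment : t ≡ increment n [mod 5 ]
    t≡increment = ≡-mod-trans (+-cong-mod (*-cong-mod a≡1 (≡⇒≡-mod refl)) (*-cong-mod b≡3 (≡⇒≡-mod refl)))
                              (≡⇒≡-mod (cong (_+ 3 * fib (suc n)) (*-identityˡ (fib n))))

  digit-progression : ∀ j n → Φ 5 (suc k) (j * m + n) ≡ (Φ 5 (suc k) n + j * increment n) % 5
  digit-progression j n = trans (sym (m%n%n≡m%n (fib (j * m + n) / e) 5))
    (%-≡ (arithmetic-progression-mod m (Φ 5 (suc k)) increment increment-return digit-return j n))

  isPeriod : IsPeriod 5 (suc k) (5 * m)
  isPeriod = z<s , λ n → begin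
    Φ 5 (suc k) (n + 5 * m)                          ≡⟨ cong (Φ 5 (suc k)) (+-comm n (5 * m)) ⟩
    Φ 5 (suc k) (5 * m + n)                          ≡⟨ digit-progression 5 n ⟩
    (Φ 5 (suc k) n + 5 * increment n) % 5            ≡⟨ %-≡ (+-multiple-≡-mod (Φ 5 (suc k) n) (m∣m*n (increment n))) ⟩
    Φ 5 (suc k) n % 5                                ≡⟨ m%n%n≡m%n (fib n / e) 5 ⟩
    Φ 5 (suc k) n                                    ∎
    where open ≡-Reasoning

  digit-count : ∀ d → d < 5 → countDigit 5 (suc k) d (5 * m) ≡ m
  digit-count d d<5 = begin
    countDigit 5 (suc k) d (5 * m)                             ≡⟨ countDigit-sum 5 (suc k) d (5 * m) ⟩
    ∑[ i < 5 * m ] indicator d (Φ 5 (suc k) (suc i))           ≡⟨ sumBelow-blocks 5 m _ ⟩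
    ∑[ i < m ] ∑[ j < 5 ] indicator d (Φ 5 (suc k) (suc (j * m + i))) ≡⟨ sumBelow-cong m hit-once ⟩
    ∑[ i < m ] 1                                               ≡⟨ sumBelow-ones m ⟩
    m                                                          ∎
    where
    open ≡-Reasoning
    hit-once : ∀ i → ∑[ j < 5 ] indicator d (Φ 5 (suc k) (suc (j * m + i))) ≡ 1
    hit-once i = trans
      (sumBelow-cong 5 (λ j → cong (indicator d) (trans (cong (Φ 5 (suc k)) (sym (+-suc (j * m) i))) (digit-progression j (suc i)))))
      (residues-hit-once (Φ 5 (suc k) (suc i)) (increment (suc i)) d (m%n<n (fib (suc i) / e) 5) (5∤increment (suc i)) d<5)

Periodic : (ℕ → ℕ) → ℕ → Set
Periodic h p = ∀ n → h (n + p) ≡ h n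

periodic-* : ∀ {h p} → Periodic h p → ∀ q → Periodic h (q * p)
periodic-* {h} {p} periodic zero    n = cong h (+-identityʳ n)
periodic-* {h} {p} periodic (suc q) n = begin
  h (n + (p + q * p)) ≡⟨ cong h (rotate n p (q * p)) ⟩
  h (n + q * p + p)   ≡⟨ periodic (n + q * p) ⟩
  h (n + q * p)       ≡⟨ periodic-* periodic q n ⟩
  h n                 ∎
  where
  open ≡-Reasoning
  rotate : ∀ x y z → x + (y + z) ≡ x + z + y
  rotate = solve-∀

periodic-% : ∀ {h P N} .{{_ : NonZero N}} → Periodic h P → Periodic h N → Periodic h (P % N)
periodic-% {h} {P} {N} periodic-P periodic-N n = begin
  h (n + P % N)                 ≡⟨ periodic-* periodic-N (P / N) (n + P % N) ⟨
  h (n + P % N + P / N * N)     ≡⟨ cong h (trans (+-assoc n (P % N) (P / N * N)) (cong (n +_) (sym (m≡m%n+[m/n]*n P N)))) ⟩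
  h (n + P)                     ≡⟨ periodic-P n ⟩
  h n                           ∎
  where open ≡-Reasoning

shortestPeriod-∣ : ∀ {β} .{{_ : NonZero β}} {k N P} → IsShortestPeriod β k N → IsPeriod β k P → N ∣ P
shortestPeriod-∣ {β} {k = k} {N} {P} ((0<N , periodic-N) , shortest) (_ , periodic-P) =
  m%n≡0⇒n∣m P N remainder≡0
  where
  instance
    N≢0 : NonZero N
    N≢0 = >-nonZero 0<N
  remainder≡0 : P % N ≡ 0
  remainder≡0 with P % N | periodic-% {h = Φ β k} periodic-P periodic-N | m%n<n P N
  ... | zero  | _        | _   = refl
  ... | suc r | periodic | r<N = ⊥-elim (<⇒≱ r<N (shortest (suc r) (z<s , periodic)))

countDigit-periodic : ∀ β .{{_ : NonZero β}} k d N q → Periodic (Φ β k) N →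
  countDigit β k d (q * N) ≡ q * countDigit β k d N
countDigit-periodic β k d N q periodic = begin
  countDigit β k d (q * N)                     ≡⟨ countDigit-sum β k d (q * N) ⟩
  ∑[ i < q * N ] indicator d (Φ β k (suc i))   ≡⟨ sumBelow-periodic q N _ shifted ⟩
  q * ∑[ i < N ] indicator d (Φ β k (suc i))   ≡⟨ cong (q *_) (countDigit-sum β k d N) ⟨
  q * countDigit β k d N                       ∎
  where
  open ≡-Reasoning
  shifted : ∀ i → indicator d (Φ β k (suc (N + i))) ≡ indicator d (Φ β k (suc i))
  shifted i = cong (indicator d) (trans (cong (λ p → Φ β k (suc p)) (+-comm N i)) (periodic (suc i)))

mainTheorem5 : (k : ℕ) → 1 ≤ k → (N : ℕ) → IsShortestPeriod 5 k N →
    (d : ℕ) → d < 5 → 5 * countDigit 5 k d N ≡ N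
mainTheorem5 zero    ()
mainTheorem5 (suc k) _ N shortest@((_ , periodic-N) , _) d d<5 = *-cancelˡ-≡ (5 * C) N q {{q≢0}} q*5C≡q*N
  where
  open ReturnPeriod (fibonacciReturn k) using (m; isPeriod; digit-count)
  open _∣_ (shortestPeriod-∣ {β = 5} {k = suc k} shortest isPeriod) renaming (quotient to q; equality to 5m≡q*N)
  C : ℕ
  C = countDigit 5 (suc k) d N
  q≢0 : NonZero q
  q≢0 = m*n≢0⇒m≢0 q {{subst NonZero 5m≡q*N _}}
  q*5C≡q*N : q * (5 * C) ≡ q * N
  q*5C≡q*N = begin
    q * (5 * C)                         ≡⟨ *-comm-middle q 5 C ⟩
    5 * (q * C)                         ≡⟨ cong (5 *_) (countDigit-periodic 5 (suc k) d N q periodic-N) ⟨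
    5 * countDigit 5 (suc k) d (q * N)  ≡⟨ cong (λ L → 5 * countDigit 5 (suc k) d L) 5m≡q*N ⟨
    5 * countDigit 5 (suc k) d (5 * m)  ≡⟨ cong (5 *_) (digit-count d d<5) ⟩
    5 * m                               ≡⟨ 5m≡q*N ⟩
    q * N                               ∎
    where
    open ≡-Reasoning
    *-comm-middle : ∀ x y z → x * (y * z) ≡ y * (x * z)
    *-comm-middle = solve-∀
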